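{- Let $p$ be a Fermat prime, i.e. a prime of the form $2^m+1$ with $m\ge1$. For a prime $q\ge5$ put $q^*=(-1)^{(q-1)/2}q$, $u_q(j)=(3^j-q^*(-1)^j)/4$, and let $D_q(n)$ be the smallest positive integer $m$ such that $u_q(1),\ldots,u_q(n)$ are pairwise incongruent modulo $m$. Then there is no prime $q\ge5$ and no $n\ge1$ with $D_q(n)=p$. -}

module Defs where

open import Data.Nat as ℕ using (ℕ; zero; suc; _≤_; _<_; _∸_)
open import Data.Nat.Primality using (Prime)
open import Data.Integer as ℤ using (ℤ; +_; -_; _-_)
open import Data.Integer.DivMod using (_/ℕ_)
open import Data.Integer.Divisibility using (_∣_)
open import Data.Product using (Σ; _×_; ∃)
open import Relation.Nullary using (¬_)
open import Relation.Binary.PropositionalEquality using (_≡_; _≢_)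

neg1^ : ℕ → ℤ
neg1^ zero = ℤ.1ℤ
neg1^ (suc k) = - neg1^ k

qStar : ℕ → ℤ
qStar q = neg1^ ((q ∸ 1) ℕ./ 2) ℤ.* + q

-- u_q(j) = (3^j - q* (-1)^j) / 4   (the division is exact for odd primes q)
u : ℕ → ℕ → ℤ
u q j = ((+ (3 ℕ.^ j)) - qStar q ℤ.* neg1^ j) /ℕ 4

PairwiseIncongruent : ℕ → ℕ → ℕ → Set
PairwiseIncongruent q n m =
  ∀ i j → 1 ≤ i → i ≤ n → 1 ≤ j → j ≤ n → i ≢ j →
  ¬ ((+ m) ∣ (u q i - u q j))

IsD : ℕ → ℕ → ℕ → Set
IsD q n m = 1 ≤ m × PairwiseIncongruent q n m ×
  (∀ k → 1 ≤ k → k < m → ¬ PairwiseIncongruent q n k)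

FermatPrime : ℕ → Set
FermatPrime p = Prime p × Σ ℕ (λ m → 1 ≤ m × p ≡ 2 ℕ.^ m ℕ.+ 1)

{-# OPTIONS --safe #-}
module Submission where

-- Write p = 2ᵐ + 1 and, q being odd, q* = 1 + 4r. Then u_q(j) = (3ʲ − (1 + 4r)(−1)ʲ)/4 is an
-- integer sequence in which consecutive terms differ by an odd number, while
-- u(i + 2e) − u(i) = 2·3ⁱ·(9ᵉ − 1)/8. Modulo the even number p − 1 = 2ᵐ an odd gap therefore
-- never vanishes, and an even gap 2e vanishes only if 2ᵐ⁻¹ divides (9ᵉ − 1)/8, i.e. (lifting
-- the exponent) only if 2ᵐ⁻¹ ∣ e, so 2e ≥ p − 1. Hence u(1), …, u(n) are pairwise incongruent
-- modulo p − 1 when n ≤ p − 1, and D_q(n) < p. When n ≥ p, Fermat's little theorem gives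
-- p ∣ (3ᵖ − 3)/4 = u(p) − u(1).

open import Defs
open import Data.Nat using (ℕ; _≤_)
open import Data.Nat.Primality using (Prime)
open import Relation.Nullary using (¬_)

module FermatsLittleTheorem where
  open import Data.Nat
  open import Data.Nat.Properties
  open import Data.Nat.Combinatorics using (_C_; nCn≡1; k![n∸k]!∣n!)
  open import Data.Nat.Combinatorics.Specification using (nCk≡n!/k![n-k]!)
  open import Data.Nat.Divisibility
  open import Data.Nat.DivMod using (m/n*n≡m)
  open import Data.Nat.Primality using (euclidsLemma; ¬prime[1])
  open import Data.Fin.Base using (Fin; zero; suc; toℕ; inject₁; fromℕ)
  open import Data.Fin.Properties using (toℕ-inject₁; toℕ-fromℕ; toℕ<n)
  open import Data.Vec.Functional using (init; last)
  open import Data.Product using (∃; _,_)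
  open import Data.Sum using (inj₁; inj₂)
  open import Function using (_∘_)
  open import Relation.Nullary using (contradiction)
  open import Relation.Binary.PropositionalEquality
  open import Algebra.Properties.CommutativeSemiring.Binomial +-*-commutativeSemiring
    using (theorem; binomialTerm)
  open import Algebra.Properties.Semiring.Exp +-*-semiring using () renaming (_^_ to _^ˢ_)
  open import Algebra.Properties.Semiring.Mult +-*-semiring using () renaming (_×_ to _×ˢ_)
  open import Algebra.Properties.Monoid.Sum +-0-monoid using (sum; sum-init-last)
  open import Data.Nat.Tactic.RingSolver using (solve-∀)
  open ≡-Reasoning

  ^ˢ≡^ : ∀ x n → x ^ˢ n ≡ x ^ n
  ^ˢ≡^ x zero = refl
  ^ˢ≡^ x (suc n) = cong (x *_) (^ˢ≡^ x n)

  ×ˢ≡* : ∀ n x → n ×ˢ x ≡ n * x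
  ×ˢ≡* zero x = refl
  ×ˢ≡* (suc n) x = cong (x +_) (×ˢ≡* n x)

  ∣-sum : ∀ {d n} (t : Fin n → ℕ) → (∀ i → d ∣ t i) → d ∣ sum t
  ∣-sum {d} {zero} t _ = d ∣0
  ∣-sum {n = suc n} t d∣t = ∣m∣n⇒∣m+n (d∣t zero) (∣-sum (t ∘ suc) (d∣t ∘ suc))

  nCk*k!*[n∸k]!≡n! : ∀ {n k} → k ≤ n → (n C k) * (k ! * (n ∸ k) !) ≡ n !
  nCk*k!*[n∸k]!≡n! {n} {k} k≤n =
    trans (cong (_* (k ! * (n ∸ k) !)) (nCk≡n!/k![n-k]! k≤n))
          (m/n*n≡m {{k !* (n ∸ k) !≢0}} (k![n∸k]!∣n! k≤n))

  prime∣n!⇒≤ : ∀ {p n} → Prime p → p ∣ n ! → p ≤ n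
  prime∣n!⇒≤ {n = zero} p-prime p∣1 = contradiction (subst Prime (∣1⇒≡1 p∣1) p-prime) ¬prime[1]
  prime∣n!⇒≤ {n = suc n} p-prime p∣[1+n]! with euclidsLemma (suc n) (n !) p-prime p∣[1+n]!
  ... | inj₁ p∣1+n = ∣⇒≤ p∣1+n
  ... | inj₂ p∣n! = m≤n⇒m≤1+n (prime∣n!⇒≤ p-prime p∣n!)

  prime∣pCk : ∀ {p k} → Prime p → 0 < k → k < p → p ∣ p C k
  prime∣pCk {p@(suc n)} {k} p-prime 0<k k<p
    with euclidsLemma (p C k) _ p-prime (subst (p ∣_) (sym (nCk*k!*[n∸k]!≡n! (<⇒≤ k<p))) (m∣m*n (n !)))
  ... | inj₁ p∣pCk = p∣pCk
  ... | inj₂ p∣k!*[p∸k]! with euclidsLemma (k !) ((p ∸ k) !) p-prime p∣k!*[p∸k]!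
  ...   | inj₁ p∣k! = contradiction (prime∣n!⇒≤ p-prime p∣k!) (<⇒≱ k<p)
  ...   | inj₂ p∣[p∸k]! = contradiction (prime∣n!⇒≤ p-prime p∣[p∸k]!) (<⇒≱ (∸-monoʳ-< 0<k (<⇒≤ k<p)))

  binomialTerm-zero : ∀ x y n → binomialTerm x y n zero ≡ y ^ n
  binomialTerm-zero x y n = trans (×ˢ≡* (n C 0) _) (trans (*-identityˡ _) (trans (*-identityˡ _) (^ˢ≡^ y n)))

  binomialTerm-fromℕ : ∀ x y n → binomialTerm x y n (fromℕ n) ≡ x ^ n
  binomialTerm-fromℕ x y n = begin
    binomialTerm x y n (fromℕ n)
      ≡⟨ ×ˢ≡* (n C toℕ (fromℕ n)) _ ⟩
    (n C toℕ (fromℕ n)) * (x ^ˢ toℕ (fromℕ n) * y ^ˢ (n ∸ toℕ (fromℕ n)))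
      ≡⟨ cong (λ j → (n C j) * (x ^ˢ j * y ^ˢ (n ∸ j))) (toℕ-fromℕ n) ⟩
    (n C n) * (x ^ˢ n * y ^ˢ (n ∸ n))
      ≡⟨ cong₂ (λ c e → c * (x ^ˢ n * y ^ˢ e)) (nCn≡1 n) (n∸n≡0 n) ⟩
    1 * (x ^ˢ n * 1)
      ≡⟨ trans (*-identityˡ _) (trans (*-identityʳ _) (^ˢ≡^ x n)) ⟩
    x ^ n ∎

  prime∣binomialTerm : ∀ {k} → Prime (suc k) → ∀ x y (i : Fin k) →
    suc k ∣ binomialTerm x y (suc k) (suc (inject₁ i))
  prime∣binomialTerm {k} p-prime x y i =
    subst (suc k ∣_) (sym (×ˢ≡* (suc k C j) _)) (∣m⇒∣m*n _ (prime∣pCk p-prime z<s j<p))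
    where
    j = suc (toℕ (inject₁ i))
    j<p : j < suc k
    j<p = s<s (subst (_< k) (sym (toℕ-inject₁ i)) (toℕ<n i))

  freshmansDream : ∀ {p} → Prime p → ∀ x y → ∃ λ s → (x + y) ^ p ≡ y ^ p + s * p + x ^ p
  freshmansDream {p@(suc k)} p-prime x y = quotient p∣middle , (begin
    (x + y) ^ p                                       ≡⟨ ^ˢ≡^ (x + y) p ⟨
    (x + y) ^ˢ p                                      ≡⟨ theorem p x y ⟩
    t zero + sum (t ∘ suc)                            ≡⟨ cong (t zero +_) (sum-init-last (t ∘ suc)) ⟩
    t zero + (sum (init (t ∘ suc)) + last (t ∘ suc))  ≡⟨ cong₂ _+_ (binomialTerm-zero x y p)
                                                           (cong₂ _+_ (m∣n⇒n≡quotient*m p∣middle) (binomialTerm-fromℕ x y p)) ⟩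
    y ^ p + (quotient p∣middle * p + x ^ p)           ≡⟨ +-assoc (y ^ p) _ _ ⟨
    y ^ p + quotient p∣middle * p + x ^ p             ∎)
    where
    t = binomialTerm x y p
    p∣middle : p ∣ sum (init (t ∘ suc))
    p∣middle = ∣-sum (init (t ∘ suc)) (prime∣binomialTerm p-prime x y)

  fermat : ∀ {p} → Prime p → ∀ a → ∃ λ s → a ^ p ≡ a + s * p
  fermat {suc k} p-prime zero = 0 , refl
  fermat {p} p-prime (suc a) with fermat p-prime a | freshmansDream p-prime 1 a
  ... | s , aᵖ≡a+sp | t , [1+a]ᵖ≡ = s + t , (begin
    (1 + a) ^ p              ≡⟨ [1+a]ᵖ≡ ⟩
    a ^ p + t * p + 1 ^ p    ≡⟨ cong₂ (λ b c → b + t * p + c) aᵖ≡a+sp (^-zeroˡ p) ⟩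
    a + s * p + t * p + 1    ≡⟨ collect a s t p ⟩
    suc a + (s + t) * p      ∎)
    where
    collect : ∀ a s t p → a + s * p + t * p + 1 ≡ suc a + (s + t) * p
    collect = solve-∀

module TwoAdic where
  open import Data.Nat
  open import Data.Nat.Properties
  open import Data.Nat.Divisibility
  open import Data.Nat.Primality using (euclidsLemma; prime[2])
  open import Data.Sum using (inj₁; inj₂)
  open import Function using (_∘_)
  open import Relation.Nullary using (contradiction)
  open import Relation.Binary.PropositionalEquality
  open import Data.Nat.Tactic.RingSolver using (solve-∀)
  open import Algebra.Properties.CommutativeSemigroup *-commutativeSemigroup using (x∙yz≈y∙xz)
  open ≡-Reasoning

  data EvenOrOdd : ℕ → Set where
    even : ∀ h → EvenOrOdd (2 * h)
    odd  : ∀ h → EvenOrOdd (1 + 2 * h)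

  evenOrOdd : ∀ n → EvenOrOdd n
  evenOrOdd zero = even 0
  evenOrOdd (suc n) with evenOrOdd n
  ... | even h = odd h
  ... | odd h = subst EvenOrOdd (*-suc 2 h) (even (suc h))

  2∤1+2* : ∀ h → ¬ 2 ∣ 1 + 2 * h
  2∤1+2* h 2∣1+2h = contradiction (∣1⇒≡1 2∣1) λ ()
    where
    2∣1 : 2 ∣ 1
    2∣1 = ∣m+n∣m⇒∣n (subst (2 ∣_) (+-comm 1 (2 * h)) 2∣1+2h) (m∣m*n h)

  2^k∣odd*x⇒2^k∣x : ∀ k {o x} → ¬ 2 ∣ o → 2 ^ k ∣ o * x → 2 ^ k ∣ x
  2^k∣odd*x⇒2^k∣x zero {x = x} _ _ = 1∣ x
  2^k∣odd*x⇒2^k∣x (suc k) {o} 2∤o 2^[1+k]∣ox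
    with euclidsLemma o _ prime[2] (∣-trans (m∣m*n (2 ^ k)) 2^[1+k]∣ox)
  ... | inj₁ 2∣o = contradiction 2∣o 2∤o
  ... | inj₂ (divides-refl y) = subst (2 * 2 ^ k ∣_) (*-comm 2 y) (*-monoʳ-∣ 2 2^k∣y)
    where
    swap : ∀ o y → o * (y * 2) ≡ 2 * (o * y)
    swap = solve-∀
    2^k∣y : 2 ^ k ∣ y
    2^k∣y = 2^k∣odd*x⇒2^k∣x k 2∤o (*-cancelˡ-∣ 2 (subst (2 * 2 ^ k ∣_) (swap o y) 2^[1+k]∣ox))

  geomSum : ℕ → ℕ → ℕ
  geomSum c zero = 0
  geomSum c (suc e) = 1 + c * geomSum c e

  [1+b]^e≡1+b*geomSum : ∀ b e → (1 + b) ^ e ≡ 1 + b * geomSum (1 + b) e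
  [1+b]^e≡1+b*geomSum b zero = cong suc (sym (*-zeroʳ b))
  [1+b]^e≡1+b*geomSum b (suc e) =
    trans (cong ((1 + b) *_) ([1+b]^e≡1+b*geomSum b e)) (expand b (geomSum (1 + b) e))
    where
    expand : ∀ b g → (1 + b) * (1 + b * g) ≡ 1 + b * (1 + (1 + b) * g)
    expand = solve-∀

  geomSum-double : ∀ c f → geomSum c (2 * f) ≡ (1 + c) * geomSum (c * c) f
  geomSum-double c zero = sym (*-zeroʳ (1 + c))
  geomSum-double c (suc f) = begin
    geomSum c (2 * suc f)                           ≡⟨ cong (geomSum c) (*-suc 2 f) ⟩
    1 + c * (1 + c * geomSum c (2 * f))             ≡⟨ cong (λ g → 1 + c * (1 + c * g)) (geomSum-double c f) ⟩
    1 + c * (1 + c * ((1 + c) * geomSum (c * c) f)) ≡⟨ expand c (geomSum (c * c) f) ⟩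
    (1 + c) * geomSum (c * c) (suc f)               ∎
    where
    expand : ∀ c g → 1 + c * (1 + c * ((1 + c) * g)) ≡ (1 + c) * (1 + c * c * g)
    expand = solve-∀

  geomSum[1+4t,2h] : ∀ t h →
    geomSum (1 + 4 * t) (2 * h) ≡ 2 * ((1 + 2 * t) * geomSum (1 + 4 * (2 * t + 4 * t * t)) h)
  geomSum[1+4t,2h] t h = begin
    geomSum (1 + 4 * t) (2 * h)
      ≡⟨ geomSum-double (1 + 4 * t) h ⟩
    (2 + 4 * t) * geomSum ((1 + 4 * t) * (1 + 4 * t)) h
      ≡⟨ cong (λ c → (2 + 4 * t) * geomSum c h) (square t) ⟩
    (2 + 4 * t) * G′
      ≡⟨ factor t G′ ⟩
    2 * ((1 + 2 * t) * G′) ∎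
    where
    square : ∀ t → (1 + 4 * t) * (1 + 4 * t) ≡ 1 + 4 * (2 * t + 4 * t * t)
    square = solve-∀
    factor : ∀ t g → (2 + 4 * t) * g ≡ 2 * ((1 + 2 * t) * g)
    factor = solve-∀
    G′ = geomSum (1 + 4 * (2 * t + 4 * t * t)) h

  -- Lifting the exponent at 2: for c ≡ 1 (mod 4), v₂((cᵉ − 1)/(c − 1)) = v₂(e).
  2^k∣geomSum[1+4t,e]⇒2^k∣e : ∀ k t e → 2 ^ k ∣ geomSum (1 + 4 * t) e → 2 ^ k ∣ e
  2^k∣geomSum[1+4t,e]⇒2^k∣e zero t e _ = 1∣ e
  2^k∣geomSum[1+4t,e]⇒2^k∣e (suc k) t e 2^[1+k]∣G with evenOrOdd e
  ... | even h = *-monoʳ-∣ 2 (2^k∣geomSum[1+4t,e]⇒2^k∣e k t′ h 2^k∣G′)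
    where
    t′ = 2 * t + 4 * t * t
    2^k∣G′ : 2 ^ k ∣ geomSum (1 + 4 * t′) h
    2^k∣G′ = 2^k∣odd*x⇒2^k∣x k (2∤1+2* t)
      (*-cancelˡ-∣ 2 (subst (2 ^ suc k ∣_) (geomSum[1+4t,2h] t h) 2^[1+k]∣G))
  ... | odd h = contradiction (subst (2 ∣_) G≡1+2*_ (∣-trans (m∣m*n (2 ^ k)) 2^[1+k]∣G)) (2∤1+2* (c * Y))
    where
    c = 1 + 4 * t
    Y = (1 + 2 * t) * geomSum (1 + 4 * (2 * t + 4 * t * t)) h
    G≡1+2*_ : geomSum c (1 + 2 * h) ≡ 1 + 2 * (c * Y)
    G≡1+2*_ = trans (cong (λ g → 1 + c * g) (geomSum[1+4t,2h] t h)) (cong suc (x∙yz≈y∙xz c 2 Y))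

  3^[2e+i]≡3^i+2*[3^i*geomSum9]*4 : ∀ e i → 3 ^ (2 * e + i) ≡ 3 ^ i + 2 * (3 ^ i * geomSum 9 e) * 4
  3^[2e+i]≡3^i+2*[3^i*geomSum9]*4 e i = begin
    3 ^ (2 * e + i)               ≡⟨ ^-distribˡ-+-* 3 (2 * e) i ⟩
    3 ^ (2 * e) * 3 ^ i           ≡⟨ cong (_* 3 ^ i) (^-*-assoc 3 2 e) ⟨
    9 ^ e * 3 ^ i                 ≡⟨ cong (_* 3 ^ i) ([1+b]^e≡1+b*geomSum 8 e) ⟩
    (1 + 8 * geomSum 9 e) * 3 ^ i ≡⟨ expand (geomSum 9 e) (3 ^ i) ⟩
    3 ^ i + 2 * (3 ^ i * geomSum 9 e) * 4 ∎
    where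
    expand : ∀ g x → (1 + 8 * g) * x ≡ x + 2 * (x * g) * 4
    expand = solve-∀

  2∤3^ : ∀ i → ¬ 2 ∣ 3 ^ i
  2∤3^ i = subst (¬_ ∘ (2 ∣_)) (sym ([1+b]^e≡1+b*geomSum 2 i)) (2∤1+2* (geomSum 3 i))

module Sequence where
  open import Data.Nat as ℕ using (zero; suc)
  import Data.Nat.Properties as ℕ
  import Data.Nat.DivMod as ℕ using (m*n/n≡m)
  import Data.Nat.Divisibility as ℕ using (_∣_; ∣1⇒≡1)
  open import Data.Integer hiding (suc)
  open import Data.Integer.Properties
  open import Data.Integer.DivMod using (a≡a%ℕn+[a/ℕn]*n; n%ℕd<d)
  open import Data.Integer.Divisibility using (_∣_)
  open import Data.Integer.Divisibility.Signed using (∣⇒∣ᵤ; ∣ᵤ⇒∣; ∣m+n∣n⇒∣m; ∣m⇒∣m*n; ∣-refl)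
  open import Data.Product using (∃; _,_)
  open import Relation.Nullary using (contradiction)
  open import Relation.Binary.PropositionalEquality
  open import Data.Integer.Tactic.RingSolver using (solve-∀)
  open ≡-Reasoning
  open TwoAdic using (even; odd; evenOrOdd; geomSum; 3^[2e+i]≡3^i+2*[3^i*geomSum9]*4)

  [i*n]/ℕn≡i : ∀ i n .{{_ : ℕ.NonZero n}} → (i * + n) /ℕ n ≡ i
  [i*n]/ℕn≡i i n = sym (i-j≡0⇒i≡j i y (∣i∣≡0⇒i≡0 (ℕ.n<1⇒n≡0 ∣i-y∣<1)))
    where
    y = (i * + n) /ℕ n
    r = (i * + n) %ℕ n
    remainder : ∀ a b → a ≡ (a + b) - b
    remainder = solve-∀
    factor : ∀ i y m → i * m - y * m ≡ (i - y) * m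
    factor = solve-∀
    r≡[i-y]*n : + r ≡ (i - y) * + n
    r≡[i-y]*n = begin
      + r                       ≡⟨ remainder (+ r) (y * + n) ⟩
      (+ r + y * + n) - y * + n ≡⟨ cong (_- y * + n) (a≡a%ℕn+[a/ℕn]*n (i * + n) n) ⟨
      i * + n - y * + n         ≡⟨ factor i y (+ n) ⟩
      (i - y) * + n             ∎
    ∣i-y∣<1 : ∣ i - y ∣ ℕ.< 1
    ∣i-y∣<1 = ℕ.*-cancelʳ-< n ∣ i - y ∣ 1
      (subst (ℕ._< 1 ℕ.* n) (trans (cong ∣_∣ r≡[i-y]*n) (abs-* (i - y) (+ n)))
        (subst (r ℕ.<_) (sym (ℕ.*-identityˡ n)) (n%ℕd<d (i * + n) n)))

  neg1^-2* : ∀ e → neg1^ (2 ℕ.* e) ≡ 1ℤ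
  neg1^-2* zero = refl
  neg1^-2* (suc e) = trans (cong neg1^ (ℕ.*-suc 2 e)) (trans (neg-involutive _) (neg1^-2* e))

  neg1^-+ : ∀ m n → neg1^ (m ℕ.+ n) ≡ neg1^ m * neg1^ n
  neg1^-+ zero n = sym (*-identityˡ (neg1^ n))
  neg1^-+ (suc m) n = trans (cong -_ (neg1^-+ m n)) (neg-distribˡ-* (neg1^ m) (neg1^ n))

  neg1^-2*+ : ∀ e i → neg1^ (2 ℕ.* e ℕ.+ i) ≡ neg1^ i
  neg1^-2*+ e i = trans (neg1^-+ (2 ℕ.* e) i) (trans (cong (_* neg1^ i) (neg1^-2* e)) (*-identityˡ (neg1^ i)))

  ∣neg1^∣≡1 : ∀ j → ∣ neg1^ j ∣ ≡ 1
  ∣neg1^∣≡1 zero = refl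
  ∣neg1^∣≡1 (suc j) = trans (∣-i∣≡∣i∣ (neg1^ j)) (∣neg1^∣≡1 j)

  2∤neg1^+2* : ∀ j w → ¬ (+ 2 ∣ neg1^ j + + 2 * w)
  2∤neg1^+2* j w 2∣neg1^+2w = contradiction (ℕ.∣1⇒≡1 2∣1) λ ()
    where
    2∣neg1^ : + 2 ∣ neg1^ j
    2∣neg1^ = ∣⇒∣ᵤ {+ 2} {neg1^ j}
      (∣m+n∣n⇒∣m (∣ᵤ⇒∣ {+ 2} {neg1^ j + + 2 * w} 2∣neg1^+2w) (∣m⇒∣m*n w ∣-refl))
    2∣1 : 2 ℕ.∣ 1
    2∣1 = subst (2 ℕ.∣_) (∣neg1^∣≡1 j) 2∣neg1^

  -- (3ʲ − (1 + 4r)(−1)ʲ)/4, given by its recurrence so that it is visibly an integer.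
  uᵣ : ℤ → ℕ → ℤ
  uᵣ r zero = - r
  uᵣ r (suc j) = + 3 * uᵣ r j + (1ℤ + + 4 * r) * neg1^ j

  uᵣ*4 : ∀ r j → + (3 ℕ.^ j) - (1ℤ + + 4 * r) * neg1^ j ≡ uᵣ r j * + 4
  uᵣ*4 r zero = base r
    where
    base : ∀ r → 1ℤ - (1ℤ + + 4 * r) * 1ℤ ≡ - r * + 4
    base = solve-∀
  uᵣ*4 r (suc j) = begin
    + (3 ℕ.* 3 ℕ.^ j) - Q * - s               ≡⟨ cong (λ x → x - Q * - s) (pos-* 3 (3 ℕ.^ j)) ⟩
    + 3 * + (3 ℕ.^ j) - Q * - s               ≡⟨ step (+ (3 ℕ.^ j)) Q s ⟩
    + 3 * (+ (3 ℕ.^ j) - Q * s) + Q * s * + 4 ≡⟨ cong (λ x → + 3 * x + Q * s * + 4) (uᵣ*4 r j) ⟩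
    + 3 * (uᵣ r j * + 4) + Q * s * + 4        ≡⟨ collect (uᵣ r j) Q s ⟩
    uᵣ r (suc j) * + 4                        ∎
    where
    Q = 1ℤ + + 4 * r
    s = neg1^ j
    step : ∀ x Q s → + 3 * x - Q * - s ≡ + 3 * (x - Q * s) + Q * s * + 4
    step = solve-∀
    collect : ∀ u Q s → + 3 * (u * + 4) + Q * s * + 4 ≡ (+ 3 * u + Q * s) * + 4
    collect = solve-∀

  u≡uᵣ : ∀ q r → qStar q ≡ 1ℤ + + 4 * r → ∀ j → u q j ≡ uᵣ r j
  u≡uᵣ q r q*≡1+4r j = begin
    (+ (3 ℕ.^ j) - qStar q * neg1^ j) /ℕ 4            ≡⟨ cong (λ x → (+ (3 ℕ.^ j) - x * neg1^ j) /ℕ 4) q*≡1+4r ⟩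
    (+ (3 ℕ.^ j) - (1ℤ + + 4 * r) * neg1^ j) /ℕ 4     ≡⟨ cong (_/ℕ 4) (uᵣ*4 r j) ⟩
    (uᵣ r j * + 4) /ℕ 4                               ≡⟨ [i*n]/ℕn≡i (uᵣ r j) 4 ⟩
    uᵣ r j                                            ∎

  +[1+2h]≡1+2*+h : ∀ h → + (1 ℕ.+ 2 ℕ.* h) ≡ 1ℤ + + 2 * + h
  +[1+2h]≡1+2*+h h = trans (pos-+ 1 (2 ℕ.* h)) (cong (_+_ 1ℤ) (pos-* 2 h))

  qStar[1+2h] : ∀ h → qStar (1 ℕ.+ 2 ℕ.* h) ≡ neg1^ h * (1ℤ + + 2 * + h)
  qStar[1+2h] h = cong₂ (λ k x → neg1^ k * x) [2h]/2≡h (+[1+2h]≡1+2*+h h)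
    where
    [2h]/2≡h : (2 ℕ.* h) ℕ./ 2 ≡ h
    [2h]/2≡h = trans (cong (ℕ._/ 2) (ℕ.*-comm 2 h)) (ℕ.m*n/n≡m h 2)

  qStar[1+2h]≡1+4* : ∀ h → ∃ λ r → qStar (1 ℕ.+ 2 ℕ.* h) ≡ 1ℤ + + 4 * r
  qStar[1+2h]≡1+4* h with evenOrOdd h
  ... | even g = + g , (begin
    qStar (1 ℕ.+ 2 ℕ.* (2 ℕ.* g))            ≡⟨ qStar[1+2h] (2 ℕ.* g) ⟩
    neg1^ (2 ℕ.* g) * (1ℤ + + 2 * + (2 ℕ.* g))
      ≡⟨ cong₂ (λ s x → s * (1ℤ + + 2 * x)) (neg1^-2* g) (pos-* 2 g) ⟩
    1ℤ * (1ℤ + + 2 * (+ 2 * + g))              ≡⟨ simplify (+ g) ⟩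
    1ℤ + + 4 * + g                             ∎)
    where
    simplify : ∀ g → 1ℤ * (1ℤ + + 2 * (+ 2 * g)) ≡ 1ℤ + + 4 * g
    simplify = solve-∀
  ... | odd g = - (1ℤ + + g) , (begin
    qStar (1 ℕ.+ 2 ℕ.* (1 ℕ.+ 2 ℕ.* g))                  ≡⟨ qStar[1+2h] (1 ℕ.+ 2 ℕ.* g) ⟩
    - neg1^ (2 ℕ.* g) * (1ℤ + + 2 * + (1 ℕ.+ 2 ℕ.* g))
      ≡⟨ cong₂ (λ s x → - s * (1ℤ + + 2 * x)) (neg1^-2* g) (+[1+2h]≡1+2*+h g) ⟩
    -1ℤ * (1ℤ + + 2 * (1ℤ + + 2 * + g))                  ≡⟨ simplify (+ g) ⟩
    1ℤ + + 4 * - (1ℤ + + g)                              ∎)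
    where
    simplify : ∀ g → -1ℤ * (1ℤ + + 2 * (1ℤ + + 2 * g)) ≡ 1ℤ + + 4 * - (1ℤ + g)
    simplify = solve-∀

  uᵣ-even-gap : ∀ r e i → uᵣ r (2 ℕ.* e ℕ.+ i) - uᵣ r i ≡ + (2 ℕ.* (3 ℕ.^ i ℕ.* geomSum 9 e))
  uᵣ-even-gap r e i = *-cancelʳ-≡ _ _ (+ 4) (begin
    (uᵣ r (2 ℕ.* e ℕ.+ i) - uᵣ r i) * + 4
      ≡⟨ distrib (uᵣ r (2 ℕ.* e ℕ.+ i)) (uᵣ r i) ⟩
    uᵣ r (2 ℕ.* e ℕ.+ i) * + 4 - uᵣ r i * + 4
      ≡⟨ cong₂ _-_ (uᵣ*4 r (2 ℕ.* e ℕ.+ i)) (uᵣ*4 r i) ⟨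
    (+ (3 ℕ.^ (2 ℕ.* e ℕ.+ i)) - Q * neg1^ (2 ℕ.* e ℕ.+ i)) - (+ (3 ℕ.^ i) - Q * neg1^ i)
      ≡⟨ cong₂ (λ x s → (x - Q * s) - (+ (3 ℕ.^ i) - Q * neg1^ i)) 3^[2e+i]≡ (neg1^-2*+ e i) ⟩
    (+ (3 ℕ.^ i) + + X * + 4 - Q * neg1^ i) - (+ (3 ℕ.^ i) - Q * neg1^ i)
      ≡⟨ cancel (+ (3 ℕ.^ i)) (+ X) (Q * neg1^ i) ⟩
    + X * + 4 ∎)
    where
    Q = 1ℤ + + 4 * r
    X = 2 ℕ.* (3 ℕ.^ i ℕ.* geomSum 9 e)
    3^[2e+i]≡ : + (3 ℕ.^ (2 ℕ.* e ℕ.+ i)) ≡ + (3 ℕ.^ i) + + X * + 4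
    3^[2e+i]≡ = trans (cong +_ (3^[2e+i]≡3^i+2*[3^i*geomSum9]*4 e i))
                      (trans (pos-+ (3 ℕ.^ i) (X ℕ.* 4)) (cong (_+_ (+ (3 ℕ.^ i))) (pos-* X 4)))
    distrib : ∀ x y → (x - y) * + 4 ≡ x * + 4 - y * + 4
    distrib = solve-∀
    cancel : ∀ a x s → (a + x * + 4 - s) - (a - s) ≡ x * + 4
    cancel = solve-∀

  uᵣ-step : ∀ r j → uᵣ r (suc j) - uᵣ r j ≡ neg1^ j + + 2 * (uᵣ r j + + 2 * r * neg1^ j)
  uᵣ-step r j = rearrange (uᵣ r j) r (neg1^ j)
    where
    rearrange : ∀ u r s → (+ 3 * u + (1ℤ + + 4 * r) * s) - u ≡ s + + 2 * (u + + 2 * r * s)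
    rearrange = solve-∀

  uᵣ-odd-gap : ∀ r e i → ¬ (+ 2 ∣ uᵣ r (suc (2 ℕ.* e ℕ.+ i)) - uᵣ r i)
  uᵣ-odd-gap r e i = subst (λ x → ¬ (+ 2 ∣ x)) (sym split) (2∤neg1^+2* m (w + + X))
    where
    m = 2 ℕ.* e ℕ.+ i
    X = 3 ℕ.^ i ℕ.* geomSum 9 e
    w = uᵣ r m + + 2 * r * neg1^ m
    telescope : ∀ a b c → a - c ≡ (a - b) + (b - c)
    telescope = solve-∀
    collect : ∀ s w x → s + + 2 * w + + 2 * x ≡ s + + 2 * (w + x)
    collect = solve-∀
    split : uᵣ r (suc m) - uᵣ r i ≡ neg1^ m + + 2 * (w + + X)
    split = begin
      uᵣ r (suc m) - uᵣ r i                       ≡⟨ telescope (uᵣ r (suc m)) (uᵣ r m) (uᵣ r i) ⟩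
      (uᵣ r (suc m) - uᵣ r m) + (uᵣ r m - uᵣ r i)
        ≡⟨ cong₂ _+_ (uᵣ-step r m) (trans (uᵣ-even-gap r e i) (pos-* 2 X)) ⟩
      neg1^ m + + 2 * w + + 2 * + X               ≡⟨ collect (neg1^ m) w (+ X) ⟩
      neg1^ m + + 2 * (w + + X)                   ∎


open import Data.Nat using (zero; suc; _+_; _*_; _^_; _∸_; _<_; s≤s; z≤n; z<s)
open import Data.Nat.Properties
import Data.Nat.Divisibility as ℕ
open import Data.Nat.Coprimality using (Coprime; coprime-divisor; prime⇒coprime)
open import Data.Nat.Primality using (¬prime[1]; prime⇒irreducible)
open import Data.Integer as ℤ using (+_; 1ℤ; _-_)
open import Data.Integer.Divisibility using (_∣_)
open import Data.Integer.Properties using (∣i-j∣≡∣j-i∣)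
open import Data.Product using (∃; _,_)
open import Data.Sum using (inj₁; inj₂)
open import Function using (_∘_)
open import Relation.Nullary using (yes; no; contradiction)
open import Relation.Binary.Definitions using (Tri; tri<; tri≈; tri>)
open import Relation.Binary.PropositionalEquality

open FermatsLittleTheorem using (fermat)
open TwoAdic
open Sequence

uᵣ-incongruent-gap : ∀ r k d i → 0 < d → d < 2 ^ suc k → ¬ (+ (2 ^ suc k) ∣ uᵣ r (d + i) - uᵣ r i)
uᵣ-incongruent-gap r k d i 0<d d<2^[1+k] 2^[1+k]∣gap with evenOrOdd d
... | odd e = uᵣ-odd-gap r e i (ℕ.∣-trans (ℕ.m∣m*n (2 ^ k)) 2^[1+k]∣gap)
... | even zero = contradiction 0<d (<-irrefl refl)
... | even e@(suc _) = <⇒≱ d<2^[1+k] (*-monoʳ-≤ 2 (ℕ.∣⇒≤ 2^k∣e))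
  where
  2^k∣3^i*G : 2 ^ k ℕ.∣ 3 ^ i * geomSum 9 e
  2^k∣3^i*G = ℕ.*-cancelˡ-∣ 2 (subst (+ (2 ^ suc k) ∣_) (uᵣ-even-gap r e i) 2^[1+k]∣gap)
  2^k∣e : 2 ^ k ℕ.∣ e
  2^k∣e = 2^k∣geomSum[1+4t,e]⇒2^k∣e k 2 e (2^k∣odd*x⇒2^k∣x k (2∤3^ i) 2^k∣3^i*G)

uᵣ-incongruent : ∀ r k {i j} → 0 < i → i < j → j ≤ 2 ^ suc k → ¬ (+ (2 ^ suc k) ∣ uᵣ r j - uᵣ r i)
uᵣ-incongruent r k {i} {j} 0<i i<j j≤2^[1+k] =
  subst (λ m → ¬ (+ (2 ^ suc k) ∣ uᵣ r m - uᵣ r i)) (m∸n+n≡m (<⇒≤ i<j))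
    (uᵣ-incongruent-gap r k (j ∸ i) i (m<n⇒0<n∸m i<j) (<-≤-trans (∸-monoʳ-< 0<i (<⇒≤ i<j)) j≤2^[1+k]))

pairwiseIncongruent-2^ : ∀ q r → qStar q ≡ 1ℤ ℤ.+ + 4 ℤ.* r →
  ∀ k {n} → n ≤ 2 ^ suc k → PairwiseIncongruent q n (2 ^ suc k)
pairwiseIncongruent-2^ q r q*≡1+4r k n≤2^[1+k] i j 1≤i i≤n 1≤j j≤n i≢j 2^[1+k]∣u[i]-u[j] =
  incongruent (<-cmp i j)
    (subst (+ (2 ^ suc k) ∣_) (cong₂ _-_ (u≡uᵣ q r q*≡1+4r i) (u≡uᵣ q r q*≡1+4r j)) 2^[1+k]∣u[i]-u[j])
  where
  incongruent : Tri (i < j) (i ≡ j) (j < i) → ¬ (+ (2 ^ suc k) ∣ uᵣ r i - uᵣ r j)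
  incongruent (tri< i<j _ _) = uᵣ-incongruent r k 1≤i i<j (≤-trans j≤n n≤2^[1+k])
                             ∘ subst (ℕ._∣_ (2 ^ suc k)) (∣i-j∣≡∣j-i∣ (uᵣ r i) (uᵣ r j))
  incongruent (tri≈ _ i≡j _) = λ _ → i≢j i≡j
  incongruent (tri> _ _ j<i) = uᵣ-incongruent r k 1≤j j<i (≤-trans i≤n n≤2^[1+k])

prime∣2*3*geomSum[9,e] : ∀ {p e} → Prime p → p ≡ 2 * e + 1 → p ℕ.∣ 2 * (3 * geomSum 9 e)
prime∣2*3*geomSum[9,e] {e = zero} p-prime refl = contradiction p-prime ¬prime[1]
prime∣2*3*geomSum[9,e] {p} {e@(suc _)} p-prime p≡2e+1 with fermat p-prime 3
... | s , 3ᵖ≡3+sp = coprime-divisor coprime[p,2] (coprime-divisor coprime[p,2] p∣2*[2*X])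
  where
  X = 2 * (3 * geomSum 9 e)
  coprime[p,2] : Coprime p 2
  coprime[p,2] = prime⇒coprime p-prime
    (subst (2 <_) (sym p≡2e+1) (≤-<-trans (*-monoʳ-≤ 2 (s≤s z≤n)) (m<m+n (2 * e) z<s)))
  X*4≡s*p : X * 4 ≡ s * p
  X*4≡s*p = +-cancelˡ-≡ 3 _ _ (begin
    3 + X * 4     ≡⟨ 3^[2e+i]≡3^i+2*[3^i*geomSum9]*4 e 1 ⟨
    3 ^ (2 * e + 1) ≡⟨ cong (3 ^_) p≡2e+1 ⟨
    3 ^ p         ≡⟨ 3ᵖ≡3+sp ⟩
    3 + s * p     ∎)
    where open ≡-Reasoning
  p∣2*[2*X] : p ℕ.∣ 2 * (2 * X)
  p∣2*[2*X] = subst (p ℕ.∣_) (trans (*-comm X 4) (*-assoc 2 2 X)) (ℕ.divides s X*4≡s*p)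

¬pairwiseIncongruent-prime : ∀ q r → qStar q ≡ 1ℤ ℤ.+ + 4 ℤ.* r →
  ∀ {p e n} → Prime p → p ≡ 2 * e + 1 → 2 * e < n → ¬ PairwiseIncongruent q n p
¬pairwiseIncongruent-prime q r q*≡1+4r {e = zero} p-prime refl _ _ = contradiction p-prime ¬prime[1]
¬pairwiseIncongruent-prime q r q*≡1+4r {p} {e@(suc _)} {n} p-prime p≡2e+1 2e<n incongruent =
  incongruent p 1 (subst (1 ≤_) (sym p≡2e+1) (m≤n+m 1 (2 * e))) p≤n ≤-refl (≤-trans (s≤s z≤n) 2e<n) p≢1
    (subst (+ p ∣_) (sym (cong₂ _-_ (u≡uᵣ q r q*≡1+4r p) (u≡uᵣ q r q*≡1+4r 1))) p∣uᵣ[p]-uᵣ[1])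
  where
  p≤n : p ≤ n
  p≤n = subst (_≤ n) (trans (+-comm 1 (2 * e)) (sym p≡2e+1)) 2e<n
  p≢1 : p ≢ 1
  p≢1 p≡1 = contradiction (subst Prime p≡1 p-prime) ¬prime[1]
  p∣uᵣ[p]-uᵣ[1] : + p ∣ uᵣ r p - uᵣ r 1
  p∣uᵣ[p]-uᵣ[1] = subst (λ m → + p ∣ uᵣ r m - uᵣ r 1) (sym p≡2e+1)
    (subst (+ p ∣_) (sym (uᵣ-even-gap r e 1)) (prime∣2*3*geomSum[9,e] {e = e} p-prime p≡2e+1))

qStar[prime]≡1+4* : ∀ q → Prime q → 2 < q → ∃ λ r → qStar q ≡ 1ℤ ℤ.+ + 4 ℤ.* r
qStar[prime]≡1+4* q q-prime 2<q with evenOrOdd q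
... | odd h = qStar[1+2h]≡1+4* h
... | even h with prime⇒irreducible q-prime (ℕ.m∣m*n h)
...   | inj₁ ()
...   | inj₂ 2≡q = contradiction 2<q (<-irrefl 2≡q)

lemma14 : (p : ℕ) → FermatPrime p →
    (q : ℕ) → Prime q → 5 ≤ q → (n : ℕ) → 1 ≤ n → ¬ IsD q n p
lemma14 p (_ , zero , () , _)
lemma14 p (p-prime , suc k , _ , p≡2^[1+k]+1) q q-prime 5≤q n _ (_ , incongruent-mod-p , minimal)
  with qStar[prime]≡1+4* q q-prime (≤-trans (s≤s (s≤s (s≤s z≤n))) 5≤q) | n ≤? 2 ^ suc k
... | r , q*≡1+4r | yes n≤p-1 =
  minimal (2 ^ suc k) (m^n>0 2 (suc k)) (subst (2 ^ suc k <_) (sym p≡2^[1+k]+1) (m<m+n _ z<s))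
    (pairwiseIncongruent-2^ q r q*≡1+4r k n≤p-1)
... | r , q*≡1+4r | no n≰p-1 =
  ¬pairwiseIncongruent-prime q r q*≡1+4r {e = 2 ^ k} p-prime p≡2^[1+k]+1 (≰⇒> n≰p-1) incongruent-mod-p
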